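{- Let $r \geq 2$ be an integer, let $A$ be a finite set of $k \geq 7$ nonnegative integers with $0\in A$, and let $H$ be a set of $t \geq 2$ positive integers with $(k-2)r-1 < \min(H) < \max(H) < (k-1)r$. Let $m_1=\lfloor \min(H)/r\rfloor$. If \[ |H^{(r)}A| = m_1 r(k-m_1)+(\min(H)-m_1 r)(k-2m_1-1)+t, \] then $H$ is an arithmetic progression with common difference $d \leq r-1$ and $A$ is an arithmetic progression with common difference $d\cdot\min(A\setminus\{0\})$.
   Context: For a finite set $A=\{a_1,\ldots,a_k\}$ of integers and positive integers $h, r$, $h^{(r)}A=\{\sum_{i=1}^k \lambda_i a_i : 0\le \lambda_i\le r,\ \sum_{i=1}^k\lambda_i=h\}$, and for a finite set $H$ of positive integers, $H^{(r)}A=\bigcup_{h\in H} h^{(r)}A$. A set is an arithmetic progression with common difference $d$ if it has the form $\{a, a+d, \ldots, a+(n-1)d\}$. -}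

module Defs where

open import Data.Nat using (ℕ; zero; suc; _+_; _*_; _∸_; _≤_; _<_; _/_)
open import Data.Integer as ℤ using (ℤ; +_)
open import Data.Fin using (Fin; zero; suc)
open import Data.List using (List; length; lookup)
open import Data.List.Membership.Propositional using (_∈_)
open import Data.List.Relation.Unary.Unique.Propositional using (Unique)
open import Data.Product using (Σ; ∃; _×_)
open import Relation.Binary.PropositionalEquality using (_≡_; _≢_)
open import Function.Bundles using (_⇔_)

sumF : ∀ {n} → (Fin n → ℕ) → ℕ
sumF {zero}  f = 0
sumF {suc n} f = f zero + sumF (λ i → f (suc i))

-- x ∈ h^(r) A, where A = {a_1,...,a_k} is given as a duplicate-free list
InRestrictedSumset : (r : ℕ) (A : List ℕ) (h : ℕ) (x : ℕ) → Set
InRestrictedSumset r A h x =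
  Σ (Fin (length A) → ℕ) λ lam →
    (∀ i → lam i ≤ r) × sumF lam ≡ h × sumF (λ i → lam i * lookup A i) ≡ x

InHrA : (r : ℕ) (H : List ℕ) (A : List ℕ) (x : ℕ) → Set
InHrA r H A x = ∃ λ h → h ∈ H × InRestrictedSumset r A h x

HasCard : (ℕ → Set) → ℕ → Set
HasCard P n = Σ (List ℕ) λ L → Unique L × length L ≡ n × (∀ x → (x ∈ L) ⇔ P x)

IsAP : List ℕ → ℕ → Set
IsAP S d = Σ ℕ λ a → Σ ℕ λ n → ∀ x → (x ∈ S) ⇔ (∃ λ i → i < n × x ≡ a + i * d)

IsMin : List ℕ → ℕ → Set
IsMin S m = m ∈ S × (∀ x → x ∈ S → m ≤ x)

IsMax : List ℕ → ℕ → Set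
IsMax S m = m ∈ S × (∀ x → x ∈ S → x ≤ m)

IsMinNonzero : List ℕ → ℕ → Set
IsMinNonzero S m = m ∈ S × m ≢ 0 × (∀ x → x ∈ S → x ≢ 0 → m ≤ x)

-- floor division (only used with r ≥ 2; the zero case is a dummy)
divFloor : ℕ → ℕ → ℕ
divFloor m zero    = 0
divFloor m (suc n) = m / suc n

formula : (r k hmin t : ℕ) → ℤ
formula r k hmin t =
  let m1 = + divFloor hmin r
      R  = + r
      K  = + k
  in (m1 ℤ.* R ℤ.* (K ℤ.- m1))
     ℤ.+ ((+ hmin ℤ.- m1 ℤ.* R) ℤ.* (K ℤ.- + 2 ℤ.* m1 ℤ.- + 1))
     ℤ.+ + t

{-# OPTIONS --safe #-}
module Submission where

-- Write k = |A|, t = |H|, hmin = (k − 2) r + s and hmax = hmin + D, so that s + D < r.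
-- Complementing coefficients (λ ↦ r − λ) maps h^(r)A bijectively onto r·ΣA − (kr − h)^(r)A,
-- so elements of H^(r)A can be produced as sums Σ μ_j b_j over the increasing enumeration
-- 0 = b 0 < … < b (k − 1) of A, with 0 ≤ μ_j ≤ r and Σ μ_j = kr − h.  Using only h = hmin and
-- h = hmax and coefficients supported on three consecutive indices, one writes down an
-- increasing chain of such sums of length N + (D + 1) − t, where N is the value of the formula.
-- As H ⊆ [hmin, hmax] gives t ≤ D + 1, the hypothesis |H^(r)A| = N forces t = D + 1, i.e.
-- H = [hmin, hmax] (common difference 1), and leaves no room outside the chain.  If two
-- consecutive gaps of b differed, the sum (r − s − 1) b i + 2 b (i + 1) + (r − 1) b (i + 2) would be
-- such an extra element; so the gaps are constant and A is a progression with difference b 1.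

open import Defs
open import Data.Nat using (ℕ; _*_; _∸_; _≤_; _<_)
open import Data.Integer using (+_)
open import Data.List using (List; length)
open import Data.List.Membership.Propositional using (_∈_)
open import Data.List.Relation.Unary.Unique.Propositional using (Unique)
open import Data.List.Relation.Unary.All using (All)
open import Data.Product using (∃; _×_)
open import Relation.Binary.PropositionalEquality using (_≡_)

open import Function using (_∘_)
open import Relation.Binary.PropositionalEquality using (_≢_; refl; sym; trans; cong; cong₂; subst; subst₂; setoid; module ≡-Reasoning)
open import Data.Nat using (zero; suc; pred; _+_; z≤n; s≤s; z<s; s<s; _<?_; _≟_; _/_; NonZero; >-nonZero)
open import Data.Nat.Properties
open import Data.Nat.DivMod using (+-distrib-/-∣ˡ; m*n/n≡m; m<n⇒m/n≡0)
open import Data.Nat.Divisibility using (divides)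
open import Data.Nat.ListAction using (sum)
open import Data.Nat.ListAction.Properties using (sum-↭)
open import Data.Nat.Tactic.RingSolver using (solve-∀)
import Data.Integer as ℤ
import Data.Integer.Properties as ℤ
import Data.Integer.Tactic.RingSolver as ℤ-Solver
open import Data.Fin using (Fin; zero; suc)
open import Data.List using ([]; _∷_; _++_; map; filter; applyUpTo; lookup)
open import Data.List.Properties using (map-applyUpTo; map-id; filter-accept; filter-none; length-map; length-++; length-applyUpTo)
open import Data.List.Membership.Propositional.Properties using (∈-∃++; ∈-applyUpTo⁺; ∈-applyUpTo⁻)
open import Data.List.Membership.DecPropositional _≟_ using (_∈?_)
open import Data.List.Relation.Binary.Subset.Propositional using (_⊆_)
open import Data.List.Relation.Binary.Permutation.Propositional using (_↭_; ↭-sym; ↭⇒↭ₛ)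
open import Data.List.Relation.Binary.Permutation.Propositional.Properties using (∈-resp-↭; ↭-length; shift; map⁺)
open import Data.List.Relation.Binary.Permutation.Setoid.Properties (setoid ℕ) using (Unique-resp-↭)
open import Data.List.Relation.Unary.Any using (here; there)
open import Data.List.Relation.Unary.All as All using ([]; _∷_)
import Data.List.Relation.Unary.All.Properties as AllP
open import Data.List.Relation.Unary.AllPairs as AllPairs using (AllPairs; []; _∷_)
import Data.List.Relation.Unary.AllPairs.Properties as AllPairsP
open import Data.List.Relation.Unary.Linked.Properties using (Linked⇒AllPairs)
open import Data.List.Sort ≤-decTotalOrder using (sort; sort-↭; sort-↗)
open import Data.Product using (_,_; proj₁; proj₂)
open import Data.Sum using (_⊎_; inj₁; inj₂)
open import Function.Bundles using (mk⇔; Equivalence)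
open import Relation.Nullary using (yes; no; contradiction)

open ≡-Reasoning

length-≤-⊆ : ∀ {xs ys : List ℕ} → Unique xs → xs ⊆ ys → length xs ≤ length ys
length-≤-⊆ {[]} _ _ = z≤n
length-≤-⊆ {x ∷ xs} {ys} (x∉xs ∷ xs!) xs⊆ys with ∈-∃++ (xs⊆ys (here refl))
... | us , vs , refl =
  subst (suc (length xs) ≤_) (sym (↭-length (shift x us vs))) (s≤s (length-≤-⊆ xs! xs⊆us++vs))
  where
  xs⊆us++vs : xs ⊆ us ++ vs
  xs⊆us++vs {y} y∈xs with ∈-resp-↭ (shift x us vs) (xs⊆ys (there y∈xs))
  ... | here y≡x = contradiction (sym y≡x) (All.lookup x∉xs y∈xs)
  ... | there y∈us++vs = y∈us++vs

⊆∧length≤⇒⊇ : ∀ {xs ys : List ℕ} → Unique xs → xs ⊆ ys → length ys ≤ length xs → ys ⊆ xs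
⊆∧length≤⇒⊇ {xs} {ys} xs! xs⊆ys ys≤xs {y} y∈ys with y ∈? xs
... | yes y∈xs = y∈xs
... | no y∉xs = contradiction (length-≤-⊆ (AllP.¬Any⇒All¬ xs y∉xs ∷ xs!) y∷xs⊆ys) (≤⇒≯ ys≤xs)
  where
  y∷xs⊆ys : y ∷ xs ⊆ ys
  y∷xs⊆ys (here refl) = y∈ys
  y∷xs⊆ys (there z∈xs) = xs⊆ys z∈xs

++-increasing : ∀ {xs ys : List ℕ} {m} → AllPairs _<_ xs → AllPairs _<_ ys →
                All (_≤ m) xs → All (m <_) ys → AllPairs _<_ (xs ++ ys)
++-increasing xs↑ ys↑ xs≤m m<ys =
  AllPairsP.++⁺ xs↑ ys↑ (All.map (λ x≤m → All.map (≤-<-trans x≤m) m<ys) xs≤m)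

applyUpTo-cong-< : ∀ {f g : ℕ → ℕ} n → (∀ {i} → i < n → f i ≡ g i) → applyUpTo f n ≡ applyUpTo g n
applyUpTo-cong-< zero _ = refl
applyUpTo-cong-< (suc n) f≡g = cong₂ _∷_ (f≡g z<s) (applyUpTo-cong-< n (f≡g ∘ s<s))

steps : ℕ → ℕ → ℕ → List ℕ
steps a d n = applyUpTo (λ i → a + suc i * d) n

steps-increasing : ∀ a {d} n → 0 < d → AllPairs _<_ (steps a d n)
steps-increasing a {d} n d>0 =
  AllPairsP.applyUpTo⁺₁ _ n (λ i<j _ → +-monoʳ-< a (*-monoˡ-< d {{>-nonZero d>0}} (s<s i<j)))

steps-above : ∀ a {d} n → 0 < d → All (a <_) (steps a d n)
steps-above a {d} n d>0 = AllP.applyUpTo⁺₁ _ n (λ {i} _ → m<m+n a (≤-trans d>0 (m≤m+n d (i * d))))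

steps-below : ∀ a d n → All (_≤ a + n * d) (steps a d n)
steps-below a d n = AllP.applyUpTo⁺₁ _ n (λ i<n → +-monoʳ-≤ a (*-monoˡ-≤ d i<n))

progression : ℕ → ℕ → ℕ → List ℕ
progression a d n = applyUpTo (λ i → a + i * d) n

length-progression : ∀ a d n → length (progression a d n) ≡ n
length-progression a d = length-applyUpTo (λ i → a + i * d)

IsAP-⊆⊇ : ∀ {xs a d n} → xs ⊆ progression a d n → progression a d n ⊆ xs → IsAP xs d
IsAP-⊆⊇ {a = a} {d} {n} xs⊆ ⊆xs = a , n , λ x → mk⇔
  (λ x∈xs → ∈-applyUpTo⁻ _ (xs⊆ x∈xs))
  (λ { (i , i<n , refl) → ⊆xs (∈-applyUpTo⁺ _ i<n) })

∈-interval : ∀ {a n x} → a ≤ x → x ≤ a + n → x ∈ progression a 1 (suc n)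
∈-interval {a} {n} {x} a≤x x≤a+n = subst (_∈ progression a 1 (suc n)) x≡ (∈-applyUpTo⁺ (λ i → a + i * 1) (s≤s x∸a≤n))
  where
  x∸a≤n : x ∸ a ≤ n
  x∸a≤n = subst (x ∸ a ≤_) (m+n∸m≡n a n) (∸-monoˡ-≤ a x≤a+n)
  x≡ : a + (x ∸ a) * 1 ≡ x
  x≡ = trans (cong (_+_ a) (*-identityʳ (x ∸ a))) (m+[n∸m]≡n a≤x)

-- Sums over Fin and the reflection h^(r)A ↦ (kr − h)^(r)A

sumF-cong : ∀ {n} {f g : Fin n → ℕ} → (∀ i → f i ≡ g i) → sumF f ≡ sumF g
sumF-cong {zero} _ = refl
sumF-cong {suc n} f≡g = cong₂ _+_ (f≡g zero) (sumF-cong (f≡g ∘ suc))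

sumF-+ : ∀ {n} (f g : Fin n → ℕ) → sumF (λ i → f i + g i) ≡ sumF f + sumF g
sumF-+ {zero} f g = refl
sumF-+ {suc n} f g = trans (cong (_+_ (f zero + g zero)) (sumF-+ (f ∘ suc) (g ∘ suc)))
                           (interchange (f zero) (g zero) (sumF (f ∘ suc)) (sumF (g ∘ suc)))
  where
  interchange : ∀ a b c d → a + b + (c + d) ≡ a + c + (b + d)
  interchange = solve-∀

sumF-*ˡ : ∀ {n} c (f : Fin n → ℕ) → sumF (λ i → c * f i) ≡ c * sumF f
sumF-*ˡ {zero} c f = sym (*-zeroʳ c)
sumF-*ˡ {suc n} c f = trans (cong (_+_ (c * f zero)) (sumF-*ˡ c (f ∘ suc)))
                            (sym (*-distribˡ-+ c (f zero) (sumF (f ∘ suc))))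

sumF-const : ∀ {n} c → sumF {n} (λ _ → c) ≡ n * c
sumF-const {zero} c = refl
sumF-const {suc n} c = cong (_+_ c) (sumF-const {n} c)

sumF-lookup : ∀ (A : List ℕ) (g : ℕ → ℕ) → sumF (λ i → g (lookup A i)) ≡ sum (map g A)
sumF-lookup [] g = refl
sumF-lookup (a ∷ A) g = cong (_+_ (g a)) (sumF-lookup A g)

reflect : ∀ {r A g h x} → InRestrictedSumset r A g x → g + h ≡ length A * r →
          x ≤ r * sum A × InRestrictedSumset r A h (r * sum A ∸ x)
reflect {r} {A} {g} {h} {x} (c , c≤r , Σc≡g , Σca≡x) g+h≡kr =
  x≤rΣA , c′ , (λ i → m∸n≤m r (c i)) , +-cancelʳ-≡ g (sumF c′) h counts , Σc′a≡
  where
  a : Fin (length A) → ℕ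
  a = lookup A
  c′ : Fin (length A) → ℕ
  c′ i = r ∸ c i
  c′+c≡r : ∀ i → c′ i + c i ≡ r
  c′+c≡r i = m∸n+n≡m (c≤r i)
  counts : sumF c′ + g ≡ h + g
  counts = begin
    sumF c′ + g               ≡⟨ cong (_+_ (sumF c′)) (sym Σc≡g) ⟩
    sumF c′ + sumF c          ≡⟨ sym (sumF-+ c′ c) ⟩
    sumF (λ i → c′ i + c i)   ≡⟨ sumF-cong c′+c≡r ⟩
    sumF {length A} (λ _ → r) ≡⟨ sumF-const {length A} r ⟩
    length A * r              ≡⟨ sym g+h≡kr ⟩
    g + h                     ≡⟨ +-comm g h ⟩
    h + g                     ∎
  weights : sumF (λ i → c′ i * a i) + x ≡ r * sum A
  weights = begin
    sumF (λ i → c′ i * a i) + x                        ≡⟨ cong (_+_ (sumF (λ i → c′ i * a i))) (sym Σca≡x) ⟩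
    sumF (λ i → c′ i * a i) + sumF (λ i → c i * a i)   ≡⟨ sym (sumF-+ (λ i → c′ i * a i) (λ i → c i * a i)) ⟩
    sumF (λ i → c′ i * a i + c i * a i)                ≡⟨ sumF-cong (λ i → trans (sym (*-distribʳ-+ (a i) (c′ i) (c i)))
                                                                                  (cong (_* a i) (c′+c≡r i))) ⟩
    sumF (λ i → r * a i)                               ≡⟨ sumF-*ˡ r a ⟩
    r * sumF a                                         ≡⟨ cong (r *_) (trans (sumF-lookup A (λ y → y)) (cong sum (map-id A))) ⟩
    r * sum A                                          ∎
  x≤rΣA : x ≤ r * sum A
  x≤rΣA = subst (x ≤_) weights (m≤n+m x _)
  Σc′a≡ : sumF (λ i → c′ i * a i) ≡ r * sum A ∸ x
  Σc′a≡ = trans (sym (m+n∸n≡m _ x)) (cong (_∸ x) weights)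

prefixSum : (ℕ → ℕ) → ℕ → ℕ
prefixSum δ zero = 0
prefixSum δ (suc j) = prefixSum δ j + δ j

prefixSum-< : ∀ {δ n i j} → (∀ {l} → suc l < n → 0 < δ l) → i < j → j < n → prefixSum δ i < prefixSum δ j
prefixSum-< {δ} {j = suc j} δ>0 (s≤s i≤j) j<n with m≤n⇒m<n∨m≡n i≤j
... | inj₁ i<j = <-trans (prefixSum-< δ>0 i<j (<-trans (n<1+n j) j<n)) (m<m+n _ (δ>0 j<n))
... | inj₂ refl = m<m+n _ (δ>0 j<n)

prefixSum-const : ∀ {δ c} j → (∀ {i} → i < j → δ i ≡ c) → prefixSum δ j ≡ j * c
prefixSum-const zero _ = refl
prefixSum-const {δ} {c} (suc j) δ≡c =
  trans (cong₂ _+_ (prefixSum-const j (δ≡c ∘ m<n⇒m<1+n)) (δ≡c (n<1+n j))) (+-comm (j * c) c)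

rank : List ℕ → ℕ → ℕ
rank xs a = length (filter (_<? a) xs)

rank-applyUpTo : ∀ {f : ℕ → ℕ} {n j} → (∀ {i j} → i < j → j < n → f i < f j) → j < n →
                 rank (applyUpTo f n) (f j) ≡ j
rank-applyUpTo {f} {suc n} {zero} f↑ _ =
  cong length (filter-none (_<? f 0) (<-irrefl refl ∷ AllP.applyUpTo⁺₁ (f ∘ suc) n
    (λ i<n → <-asym (f↑ z<s (s<s i<n)))))
rank-applyUpTo {f} {suc n} {suc j} f↑ (s<s j<n) =
  trans (cong length (filter-accept (_<? f (suc j)) {xs = applyUpTo (f ∘ suc) n} (f↑ z<s (s<s j<n))))
        (cong suc (rank-applyUpTo (λ i<j j<n → f↑ (s<s i<j) (s<s j<n)) j<n))

sum-by-rank : ∀ {f : ℕ → ℕ} {n} → (∀ {i j} → i < j → j < n → f i < f j) → (G : ℕ → ℕ → ℕ) →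
              sum (map (λ a → G (rank (applyUpTo f n) a) a) (applyUpTo f n)) ≡ sum (applyUpTo (λ j → G j (f j)) n)
sum-by-rank {f} {n} f↑ G = cong sum (trans (map-applyUpTo f _ n)
  (applyUpTo-cong-< n (λ {j} j<n → cong (λ ρ → G ρ (f j)) (rank-applyUpTo f↑ j<n))))

triple : ℕ → ℕ → ℕ → ℕ → ℕ → ℕ
triple zero    x y z zero                = x
triple zero    x y z (suc zero)          = y
triple zero    x y z (suc (suc zero))    = z
triple zero    x y z (suc (suc (suc _))) = 0
triple (suc i) x y z zero                = 0
triple (suc i) x y z (suc j)             = triple i x y z j

triple-≤ : ∀ {r x y z} → x ≤ r → y ≤ r → z ≤ r → ∀ i j → triple i x y z j ≤ r
triple-≤ x≤r y≤r z≤r zero zero                = x≤r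
triple-≤ x≤r y≤r z≤r zero (suc zero)          = y≤r
triple-≤ x≤r y≤r z≤r zero (suc (suc zero))    = z≤r
triple-≤ x≤r y≤r z≤r zero (suc (suc (suc _))) = z≤n
triple-≤ x≤r y≤r z≤r (suc i) zero             = z≤n
triple-≤ x≤r y≤r z≤r (suc i) (suc j)          = triple-≤ x≤r y≤r z≤r i j

sum-applyUpTo-0 : ∀ {f : ℕ → ℕ} n → (∀ j → f j ≡ 0) → sum (applyUpTo f n) ≡ 0
sum-applyUpTo-0 zero _ = refl
sum-applyUpTo-0 (suc n) f≡0 = cong₂ _+_ (f≡0 0) (sum-applyUpTo-0 n (f≡0 ∘ suc))

sum-triple : ∀ {x y z} (F : ℕ → ℕ → ℕ) → (∀ j → F j 0 ≡ 0) → ∀ i {n} → 3 + i ≤ n →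
             sum (applyUpTo (λ j → F j (triple i x y z j)) n) ≡ F i x + F (1 + i) y + F (2 + i) z
sum-triple {x} {y} {z} F F0 zero {suc (suc (suc n))} _ =
  trans (cong (λ σ → F 0 x + (F 1 y + (F 2 z + σ))) (sum-applyUpTo-0 n (F0 ∘ (_+_ 3))))
        (reassociate (F 0 x) (F 1 y) (F 2 z))
  where
  reassociate : ∀ a b c → a + (b + (c + 0)) ≡ a + b + c
  reassociate = solve-∀
sum-triple F F0 zero {suc zero} (s≤s ())
sum-triple F F0 zero {suc (suc zero)} (s≤s (s≤s ()))
sum-triple F F0 (suc i) {suc n} (s≤s 3+i≤n) = cong₂ _+_ (F0 0) (sum-triple (F ∘ suc) (F0 ∘ suc) i 3+i≤n)

-- A = {b 0 < b 1 < … < b (k − 1)} with b = prefixSum gap; in particular min A = b 0 = 0.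
record IncreasingEnumeration (A : List ℕ) : Set where
  field
    gap        : ℕ → ℕ
    gap-pos    : ∀ {j} → suc j < length A → 0 < gap j
    enumerates : applyUpTo (prefixSum gap) (length A) ↭ A

  b : ℕ → ℕ
  b = prefixSum gap

  b-increasing : ∀ {i j} → i < j → j < length A → b i < b j
  b-increasing = prefixSum-< gap-pos

  ∈⇒enumerated : ∀ {x} → x ∈ A → ∃ λ j → j < length A × x ≡ b j
  ∈⇒enumerated x∈A = ∈-applyUpTo⁻ b (∈-resp-↭ (↭-sym enumerates) x∈A)

  enumerated-∈ : ∀ {j} → j < length A → b j ∈ A
  enumerated-∈ j<k = ∈-resp-↭ enumerates (∈-applyUpTo⁺ b j<k)

  -- a ∈ A receives the coefficient of its position in the enumeration, which is its rank
  three-term-∈ : ∀ {r i x y z} → 3 + i ≤ length A → x ≤ r → y ≤ r → z ≤ r →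
                 InRestrictedSumset r A (x + y + z) (x * b i + y * b (1 + i) + z * b (2 + i))
  three-term-∈ {r} {i} {x} {y} {z} 3+i≤k x≤r y≤r z≤r =
    coefficient , (λ ι → triple-≤ x≤r y≤r z≤r i (position ι)) ,
    trans (sumF-by-position (λ j _ → triple i x y z j)) (sum-triple (λ _ c → c) (λ _ → refl) i 3+i≤k) ,
    trans (sumF-by-position (λ j a → triple i x y z j * a)) (sum-triple (λ j c → c * b j) (λ _ → refl) i 3+i≤k)
    where
    E : List ℕ
    E = applyUpTo b (length A)
    position : Fin (length A) → ℕ
    position ι = rank E (lookup A ι)
    coefficient : Fin (length A) → ℕ
    coefficient ι = triple i x y z (position ι)
    sumF-by-position : ∀ (G : ℕ → ℕ → ℕ) →
      sumF (λ ι → G (position ι) (lookup A ι)) ≡ sum (applyUpTo (λ j → G j (b j)) (length A))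
    sumF-by-position G = begin
      sumF (λ ι → G (position ι) (lookup A ι))      ≡⟨ sumF-lookup A (λ a → G (rank E a) a) ⟩
      sum (map (λ a → G (rank E a) a) A)            ≡⟨ sum-↭ (map⁺ _ (↭-sym enumerates)) ⟩
      sum (map (λ a → G (rank E a) a) E)            ≡⟨ sum-by-rank b-increasing G ⟩
      sum (applyUpTo (λ j → G j (b j)) (length A))  ∎

  minNonzero≡gap₀ : ∀ {a₁} → 2 ≤ length A → IsMinNonzero A a₁ → a₁ ≡ gap 0
  minNonzero≡gap₀ 2≤k (a₁∈A , a₁≢0 , a₁-min) with ∈⇒enumerated a₁∈A
  ... | zero , _ , a₁≡0 = contradiction a₁≡0 a₁≢0
  ... | suc j , j<k , a₁≡ = ≤-antisym (a₁-min (gap 0) (enumerated-∈ 2≤k) (>⇒≢ (gap-pos 2≤k)))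
                                      (subst (b 1 ≤_) (sym a₁≡) (b₁≤ j j<k))
    where
    b₁≤ : ∀ j → suc j < length A → b 1 ≤ b (suc j)
    b₁≤ zero _ = ≤-refl
    b₁≤ (suc j) j<k = <⇒≤ (b-increasing (s<s z<s) j<k)

  IsAP-of-constant-gaps : (∀ {i} → 3 + i ≤ length A → gap i ≡ gap (1 + i)) → IsAP A (gap 0)
  IsAP-of-constant-gaps gap-step = 0 , length A , λ x → mk⇔
    (λ x∈A → let (j , j<k , x≡) = ∈⇒enumerated x∈A in j , j<k , trans x≡ (b≡ j<k))
    (λ { (j , j<k , refl) → subst (_∈ A) (b≡ j<k) (enumerated-∈ j<k) })
    where
    gap≡gap₀ : ∀ {j} → suc j < length A → gap j ≡ gap 0
    gap≡gap₀ {zero} _ = refl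
    gap≡gap₀ {suc j} j<k = trans (sym (gap-step j<k)) (gap≡gap₀ (<-trans (n<1+n _) j<k))
    b≡ : ∀ {j} → j < length A → b j ≡ j * gap 0
    b≡ {j} j<k = prefixSum-const j (λ i<j → gap≡gap₀ (≤-<-trans i<j j<k))

nth : List ℕ → ℕ → ℕ
nth [] _ = 0
nth (x ∷ xs) zero = x
nth (x ∷ xs) (suc j) = nth xs j

applyUpTo-nth : ∀ xs → applyUpTo (nth xs) (length xs) ≡ xs
applyUpTo-nth [] = refl
applyUpTo-nth (x ∷ xs) = cong (x ∷_) (applyUpTo-nth xs)

nth-< : ∀ {xs j} → AllPairs _<_ xs → suc j < length xs → nth xs j < nth xs (suc j)
nth-< {x ∷ y ∷ xs} {zero} ((x<y ∷ _) ∷ _) _ = x<y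
nth-< {x ∷ xs} {suc j} (_ ∷ xs↑) (s<s j<) = nth-< xs↑ j<

nth-0 : ∀ {xs} → AllPairs _<_ xs → 0 ∈ xs → nth xs 0 ≡ 0
nth-0 _ (here 0≡x) = sym 0≡x
nth-0 (x<xs ∷ _) (there 0∈xs) = contradiction (All.lookup x<xs 0∈xs) n≮0

gaps : List ℕ → ℕ → ℕ
gaps xs j = nth xs (suc j) ∸ nth xs j

prefixSum-gaps : ∀ {xs j} → AllPairs _<_ xs → 0 ∈ xs → j < length xs → prefixSum (gaps xs) j ≡ nth xs j
prefixSum-gaps {j = zero} xs↑ 0∈xs _ = sym (nth-0 xs↑ 0∈xs)
prefixSum-gaps {xs} {suc j} xs↑ 0∈xs j<n =
  trans (cong (_+ gaps xs j) (prefixSum-gaps xs↑ 0∈xs (<-trans (n<1+n j) j<n))) (m+[n∸m]≡n (<⇒≤ (nth-< xs↑ j<n)))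

enumerate : ∀ {A} → Unique A → 0 ∈ A → IncreasingEnumeration A
enumerate {A} A! 0∈A = record
  { gap        = gaps S
  ; gap-pos    = λ j<k → m<n⇒0<n∸m (nth-< S↑ (subst (suc _ <_) (sym |S|≡|A|) j<k))
  ; enumerates = subst (λ n → applyUpTo (prefixSum (gaps S)) n ↭ A) |S|≡|A| (subst (_↭ A) (sym S≡) (sort-↭ A))
  }
  where
  S : List ℕ
  S = sort A
  S↑ : AllPairs _<_ S
  S↑ = AllPairs.map (λ (x≤y , x≢y) → ≤∧≢⇒< x≤y x≢y)
         (AllPairs.zip (Linked⇒AllPairs ≤-trans (sort-↗ A) , Unique-resp-↭ (↭⇒↭ₛ (↭-sym (sort-↭ A))) A!))
  |S|≡|A| : length S ≡ length A
  |S|≡|A| = ↭-length (sort-↭ A)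
  S≡ : applyUpTo (prefixSum (gaps S)) (length S) ≡ S
  S≡ = trans (applyUpTo-cong-< (length S) (prefixSum-gaps S↑ (∈-resp-↭ (↭-sym (sort-↭ A)) 0∈A)))
             (applyUpTo-nth S)

-- A long increasing chain of three-term sums

-- The two coefficient totals r + u and r + suc w stand for kr − hmin and kr − hmax.
module Chain
  (δ : ℕ → ℕ) (k r u w : ℕ) (Mem : ℕ → Set)
  (δ-pos : ∀ {j} → suc j < k → 0 < δ j)
  (3≤k : 3 ≤ k) (2≤r : 2 ≤ r) (u≤r : u ≤ r) (w<u : w < u)
  (three-term : ∀ {i x y z} → 3 + i ≤ k → x ≤ r → y ≤ r → z ≤ r →
                x + y + z ≡ r + u ⊎ x + y + z ≡ r + suc w →
                Mem (x * prefixSum δ i + y * prefixSum δ (1 + i) + z * prefixSum δ (2 + i)))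
  where

  b : ℕ → ℕ
  b = prefixSum δ

  mem : ∀ {i x y z v} → 3 + i ≤ k → x ≤ r → y ≤ r → z ≤ r →
        x + y + z ≡ r + u ⊎ x + y + z ≡ r + suc w → v ≡ x * b i + y * b (1 + i) + z * b (2 + i) → Mem v
  mem 3+i≤k x≤r y≤r z≤r total refl = three-term 3+i≤k x≤r y≤r z≤r total

  w≤r : w ≤ r
  w≤r = ≤-trans (<⇒≤ w<u) u≤r

  V : ℕ → ℕ
  V q = u * b q + r * b (1 + q)

  V-step : ∀ q → V (1 + q) ≡ V q + r * δ (1 + q) + u * δ q
  V-step q = expand u r (b q) (δ q) (δ (1 + q))
    where
    expand : ∀ u r B d d′ → u * (B + d) + r * (B + d + d′) ≡ u * B + r * (B + d) + r * d′ + u * d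
    expand = solve-∀

  V-mono : ∀ q → V q ≤ V (1 + q)
  V-mono q = subst (V q ≤_) (sym (V-step q)) (≤-trans (m≤m+n (V q) _) (m≤m+n _ _))

  base : List ℕ
  base = steps (w * δ 0) (δ 0) (r ∸ w)

  ext : ℕ → List ℕ
  ext q = steps (V q) (δ (1 + q)) r ++ steps (V q + r * δ (1 + q)) (δ q) u

  -- From the multiples (w + 1) b 1, …, r b 1, the chain passes from V q to V (q + 1) by moving the
  -- r units at b (q + 1) one at a time to b (q + 2), then the u units at b q to b (q + 1).
  chain : ℕ → List ℕ
  chain zero = base
  chain (suc q) = chain q ++ ext q

  base-below : All (_≤ V 0) base
  base-below = subst (λ v → All (_≤ v) base) end (steps-below (w * δ 0) (δ 0) (r ∸ w))
    where
    end : w * δ 0 + (r ∸ w) * δ 0 ≡ V 0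
    end = begin
      w * δ 0 + (r ∸ w) * δ 0  ≡⟨ sym (*-distribʳ-+ (δ 0) w (r ∸ w)) ⟩
      (w + (r ∸ w)) * δ 0      ≡⟨ cong (_* δ 0) (m+[n∸m]≡n w≤r) ⟩
      r * δ 0                  ≡⟨ cong (_+ r * δ 0) (sym (*-zeroʳ u)) ⟩
      u * 0 + r * δ 0          ∎

  base-mem : All Mem base
  base-mem = AllP.applyUpTo⁺₁ _ (r ∸ w) element
    where
    element : ∀ {t} → t < r ∸ w → Mem (w * δ 0 + suc t * δ 0)
    element {t} t<r∸w = mem 3≤k (m∸n≤m r t) y≤r z≤n (inj₂ total) (value (r ∸ t) w t (δ 0) (δ 0 + δ 1))
      where
      y≤r : suc w + t ≤ r
      y≤r = subst₂ _≤_ (+-suc w t) (m+[n∸m]≡n w≤r) (+-monoʳ-≤ w t<r∸w)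
      total : r ∸ t + (suc w + t) + 0 ≡ r + suc w
      total = trans (rearrange (r ∸ t) w t) (cong (_+ suc w) (m∸n+n≡m (≤-trans (<⇒≤ t<r∸w) (m∸n≤m r w))))
        where
        rearrange : ∀ x w t → x + (suc w + t) + 0 ≡ x + t + suc w
        rearrange = solve-∀
      value : ∀ x w t d e → w * d + suc t * d ≡ x * 0 + (suc w + t) * d + 0 * e
      value = solve-∀

  ext-increasing : ∀ {q} → 3 + q ≤ k → AllPairs _<_ (ext q)
  ext-increasing {q} 3+q≤k =
    ++-increasing (steps-increasing (V q) r (δ-pos 3+q≤k)) (steps-increasing (V q + r * δ (1 + q)) u (δ-pos (<⇒≤ 3+q≤k)))
                  (steps-below (V q) (δ (1 + q)) r) (steps-above (V q + r * δ (1 + q)) u (δ-pos (<⇒≤ 3+q≤k)))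

  ext-above : ∀ {q} → 3 + q ≤ k → All (V q <_) (ext q)
  ext-above {q} 3+q≤k = AllP.++⁺ (steps-above (V q) r (δ-pos 3+q≤k))
    (All.map (≤-<-trans (m≤m+n (V q) _)) (steps-above (V q + r * δ (1 + q)) u (δ-pos (<⇒≤ 3+q≤k))))

  ext-below : ∀ q → All (_≤ V (1 + q)) (ext q)
  ext-below q = subst (λ v → All (_≤ v) (ext q)) (sym (V-step q))
    (AllP.++⁺ (All.map (λ x≤ → ≤-trans x≤ (m≤m+n _ _)) (steps-below (V q) (δ (1 + q)) r))
              (steps-below (V q + r * δ (1 + q)) (δ q) u))

  ext-mem : ∀ {q} → 3 + q ≤ k → All Mem (ext q)
  ext-mem {q} 3+q≤k = AllP.++⁺ (AllP.applyUpTo⁺₁ _ r climb) (AllP.applyUpTo⁺₁ _ u descend)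
    where
    climb : ∀ {t} → t < r → Mem (V q + suc t * δ (1 + q))
    climb {t} t<r = mem 3+q≤k u≤r (m∸n≤m r (suc t)) t<r (inj₁ total) value
      where
      total : u + (r ∸ suc t) + suc t ≡ r + u
      total = trans (+-assoc u _ _) (trans (cong (_+_ u) (m∸n+n≡m t<r)) (+-comm u r))
      shift-mass : ∀ u c n B B′ d → u * B + (c + n) * B′ + n * d ≡ u * B + c * B′ + n * (B′ + d)
      shift-mass = solve-∀
      value : V q + suc t * δ (1 + q) ≡ u * b q + (r ∸ suc t) * b (1 + q) + suc t * b (2 + q)
      value = trans (cong (λ ρ → u * b q + ρ * b (1 + q) + suc t * δ (1 + q)) (sym (m∸n+n≡m t<r)))
                    (shift-mass u (r ∸ suc t) (suc t) (b q) (b (1 + q)) (δ (1 + q)))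
    descend : ∀ {t} → t < u → Mem (V q + r * δ (1 + q) + suc t * δ q)
    descend {t} t<u = mem 3+q≤k (≤-trans (m∸n≤m u (suc t)) u≤r) (≤-trans t<u u≤r) ≤-refl (inj₁ total) value
      where
      total : u ∸ suc t + suc t + r ≡ r + u
      total = trans (cong (_+ r) (m∸n+n≡m t<u)) (+-comm u r)
      shift-mass : ∀ c n r B d d′ → (c + n) * B + r * (B + d) + r * d′ + n * d ≡ c * B + n * (B + d) + r * (B + d + d′)
      shift-mass = solve-∀
      value : V q + r * δ (1 + q) + suc t * δ q ≡ (u ∸ suc t) * b q + suc t * b (1 + q) + r * b (2 + q)
      value = trans (cong (λ υ → υ * b q + r * b (1 + q) + r * δ (1 + q) + suc t * δ q) (sym (m∸n+n≡m t<u)))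
                    (shift-mass (u ∸ suc t) (suc t) r (b q) (δ q) (δ (1 + q)))

  chain-below : ∀ q → All (_≤ V q) (chain q)
  chain-below zero = base-below
  chain-below (suc q) = AllP.++⁺ (All.map (λ x≤ → ≤-trans x≤ (V-mono q)) (chain-below q)) (ext-below q)

  chain-increasing : ∀ q → 2 + q ≤ k → AllPairs _<_ (chain q)
  chain-increasing zero 2≤k = steps-increasing (w * δ 0) (r ∸ w) (δ-pos 2≤k)
  chain-increasing (suc q) 3+q≤k =
    ++-increasing (chain-increasing q (<⇒≤ 3+q≤k)) (ext-increasing 3+q≤k) (chain-below q) (ext-above 3+q≤k)

  chain-mem : ∀ q → 2 + q ≤ k → All Mem (chain q)
  chain-mem zero _ = base-mem
  chain-mem (suc q) 3+q≤k = AllP.++⁺ (chain-mem q (<⇒≤ 3+q≤k)) (ext-mem 3+q≤k)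

  length-chain : ∀ q → w + length (chain q) ≡ r + q * (r + u)
  length-chain zero = begin
    w + length base  ≡⟨ cong (_+_ w) (length-applyUpTo _ (r ∸ w)) ⟩
    w + (r ∸ w)      ≡⟨ m+[n∸m]≡n w≤r ⟩
    r                ≡⟨ sym (+-identityʳ r) ⟩
    r + 0            ∎
  length-chain (suc q) = begin
    w + length (chain q ++ ext q)           ≡⟨ cong (_+_ w) (length-++ (chain q)) ⟩
    w + (length (chain q) + length (ext q)) ≡⟨ sym (+-assoc w _ _) ⟩
    w + length (chain q) + length (ext q)   ≡⟨ cong₂ _+_ (length-chain q) length-ext ⟩
    r + q * (r + u) + (r + u)               ≡⟨ regroup r q (r + u) ⟩
    r + suc q * (r + u)                     ∎
    where
    length-ext : length (ext q) ≡ r + u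
    length-ext = trans (length-++ (steps (V q) (δ (1 + q)) r))
                       (cong₂ _+_ (length-applyUpTo _ r) (length-applyUpTo _ u))
    regroup : ∀ r q c → r + q * c + c ≡ r + suc q * c
    regroup = solve-∀

  -- The sum (u − 1) b q + 2 b (q + 1) + (r − 1) b (q + 2), which the chain skips unless δ q ≡ δ (q + 1).
  Y : ℕ → ℕ
  Y q = V q + (δ q + pred r * δ (1 + q))

  instance
    r-nonZero : NonZero r
    r-nonZero = >-nonZero (≤-trans (s≤s z≤n) 2≤r)
    u-nonZero : NonZero u
    u-nonZero = >-nonZero (≤-trans (s≤s z≤n) w<u)

  Y-mem : ∀ {q} → 3 + q ≤ k → Mem (Y q)
  Y-mem {q} 3+q≤k = mem 3+q≤k (≤-trans pred[n]≤n u≤r) 2≤r pred[n]≤n (inj₁ total) value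
    where
    total : pred u + 2 + pred r ≡ r + u
    total = trans (rearrange (pred u) (pred r)) (cong₂ _+_ (suc-pred r) (suc-pred u))
      where
      rearrange : ∀ a c → a + 2 + c ≡ suc c + suc a
      rearrange = solve-∀
    spread : ∀ a c B d d′ → suc a * B + suc c * (B + d) + (d + c * d′) ≡ a * B + 2 * (B + d) + c * (B + d + d′)
    spread = solve-∀
    value : Y q ≡ pred u * b q + 2 * b (1 + q) + pred r * b (2 + q)
    value = trans (cong₂ (λ υ ρ → υ * b q + ρ * b (1 + q) + (δ q + pred r * δ (1 + q))) (sym (suc-pred u)) (sym (suc-pred r)))
                  (spread (pred u) (pred r) (b q) (δ q) (δ (1 + q)))

  Y-below : ∀ {q c} → 3 + q ≤ k → δ q ≤ c → Y q < V q + r * δ (1 + q) + c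
  Y-below {q} {c} 3+q≤k δ≤c = subst (Y q <_) (sym (+-assoc (V q) _ c)) (+-monoʳ-< (V q)
    (subst (δ q + pred r * δ (1 + q) <_) (+-comm c _)
      (+-mono-≤-< δ≤c (*-monoˡ-< (δ (1 + q)) {{>-nonZero (δ-pos 3+q≤k)}} (subst (pred r <_) (suc-pred r) (n<1+n (pred r)))))))

  V<Y : ∀ {q} → 3 + q ≤ k → V q < Y q
  V<Y {q} 3+q≤k = m<m+n (V q) (≤-trans (δ-pos (<⇒≤ 3+q≤k)) (m≤m+n _ _))

  Y<V : ∀ {q} → 3 + q ≤ k → Y q < V (1 + q)
  Y<V {q} 3+q≤k = subst (Y q <_) (sym (V-step q)) (Y-below 3+q≤k (m≤n*m (δ q) u))

  Y∉ext : ∀ {q} → 3 + q ≤ k → δ q ≢ δ (1 + q) → All (Y q ≢_) (ext q)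
  Y∉ext {q} 3+q≤k δ≢δ′ = AllP.++⁺ (AllP.applyUpTo⁺₁ _ r climb) (AllP.applyUpTo⁺₁ _ u descend)
    where
    climb : ∀ {t} → t < r → Y q ≢ V q + suc t * δ (1 + q)
    climb {t} t<r with m≤n⇒m<n∨m≡n (<⇒≤pred t<r)
    ... | inj₁ t<pred-r = >⇒≢ (+-monoʳ-< (V q) (≤-<-trans (*-monoˡ-≤ (δ (1 + q)) t<pred-r)
                                                          (m<n+m _ (δ-pos (<⇒≤ 3+q≤k)))))
    ... | inj₂ refl = λ Y≡ → δ≢δ′ (+-cancelʳ-≡ (pred r * δ (1 + q)) _ _ (+-cancelˡ-≡ (V q) _ _ Y≡))
    descend : ∀ {t} → t < u → Y q ≢ V q + r * δ (1 + q) + suc t * δ q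
    descend {t} _ = <⇒≢ (Y-below 3+q≤k (m≤m+n (δ q) (t * δ q)))

  Y∉chain : ∀ {i q} → δ i ≢ δ (1 + i) → i < q → 2 + q ≤ k → All (Y i ≢_) (chain q) × Y i < V q
  Y∉chain {i} {suc q} δ≢δ′ (s≤s i≤q) 3+q≤k with m≤n⇒m<n∨m≡n i≤q
  ... | inj₂ refl = AllP.++⁺ (All.map (λ x≤V → >⇒≢ (≤-<-trans x≤V (V<Y 3+q≤k))) (chain-below q)) (Y∉ext 3+q≤k δ≢δ′)
                  , Y<V 3+q≤k
  ... | inj₁ i<q with Y∉chain δ≢δ′ i<q (<⇒≤ 3+q≤k)
  ...   | Y∉chain-q , Y<Vq = AllP.++⁺ Y∉chain-q (All.map (λ V<x → <⇒≢ (<-trans Y<Vq V<x)) (ext-above 3+q≤k))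
                           , <-≤-trans Y<Vq (V-mono q)

-- Counting elements of H^(r)A

HasCard-≥ : ∀ {P : ℕ → Set} {N xs} → HasCard P N → Unique xs → All P xs → length xs ≤ N
HasCard-≥ (L , _ , |L|≡N , ∈L⇔P) xs! Pxs =
  subst (_ ≤_) |L|≡N (length-≤-⊆ xs! (λ {x} x∈xs → Equivalence.from (∈L⇔P x) (All.lookup Pxs x∈xs)))

∸-injective : ∀ {R x y} → x ≤ R → y ≤ R → R ∸ x ≡ R ∸ y → x ≡ y
∸-injective {R} x≤R y≤R eq = trans (sym (m∸[m∸n]≡n x≤R)) (trans (cong (R ∸_) eq) (m∸[m∸n]≡n y≤R))

Unique-map-∸ : ∀ {R xs} → Unique xs → All (_≤ R) xs → Unique (map (R ∸_) xs)
Unique-map-∸ [] [] = []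
Unique-map-∸ (x∉xs ∷ xs!) (x≤R ∷ xs≤R) =
  AllP.map⁺ (All.zipWith (λ (x≢y , y≤R) eq → x≢y (∸-injective x≤R y≤R eq)) (x∉xs , xs≤R)) ∷ Unique-map-∸ xs! xs≤R

module LowerBound
  {r u w : ℕ} (2≤r : 2 ≤ r) (u≤r : u ≤ r) (w<u : w < u)
  {A : List ℕ} {m : ℕ} (k≡ : length A ≡ 3 + m) (e : IncreasingEnumeration A)
  {H : List ℕ} {hmin hmax : ℕ} (hmin∈H : hmin ∈ H) (hmax∈H : hmax ∈ H)
  (hmin-total : hmin + (r + u) ≡ length A * r) (hmax-total : hmax + (r + suc w) ≡ length A * r)
  where

  open IncreasingEnumeration e

  R : ℕ
  R = r * sum A

  Reflected : ℕ → Set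
  Reflected v = v ≤ R × InHrA r H A (R ∸ v)

  reflected : ∀ {g h v} → h ∈ H → g + h ≡ length A * r → InRestrictedSumset r A g v → Reflected v
  reflected h∈H g+h≡kr v∈ = let (v≤R , R∸v∈) = reflect {A = A} v∈ g+h≡kr in v≤R , _ , h∈H , R∸v∈

  three-term-reflected : ∀ {i x y z} → 3 + i ≤ 3 + m → x ≤ r → y ≤ r → z ≤ r →
                         x + y + z ≡ r + u ⊎ x + y + z ≡ r + suc w → Reflected (x * b i + y * b (1 + i) + z * b (2 + i))
  three-term-reflected 3+i≤k x≤r y≤r z≤r total = reflected-total total (three-term-∈ (subst (_ ≤_) (sym k≡) 3+i≤k) x≤r y≤r z≤r)
    where
    reflected-total : ∀ {g v} → g ≡ r + u ⊎ g ≡ r + suc w → InRestrictedSumset r A g v → Reflected v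
    reflected-total (inj₁ refl) = reflected hmin∈H (trans (+-comm _ hmin) hmin-total)
    reflected-total (inj₂ refl) = reflected hmax∈H (trans (+-comm _ hmax) hmax-total)

  open Chain gap (3 + m) r u w Reflected (gap-pos ∘ subst (suc _ <_) (sym k≡)) (s≤s (s≤s (s≤s z≤n))) 2≤r u≤r w<u three-term-reflected
    using (chain; chain-increasing; chain-mem; length-chain; Y; Y-mem; Y∉chain)

  count : ∀ {N xs} → HasCard (InHrA r H A) N → Unique xs → All Reflected xs → length xs ≤ N
  count {xs = xs} card xs! xs-reflected = subst (_≤ _) (length-map (R ∸_) xs)
    (HasCard-≥ card (Unique-map-∸ xs! (All.map proj₁ xs-reflected)) (AllP.map⁺ (All.map proj₂ xs-reflected)))

  full-chain : List ℕ
  full-chain = chain (1 + m)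

  length-full-chain : w + length full-chain ≡ r + (1 + m) * (r + u)
  length-full-chain = length-chain (1 + m)

  full-chain-unique : Unique full-chain
  full-chain-unique = AllPairs.map <⇒≢ (chain-increasing (1 + m) ≤-refl)

  lower-bound : ∀ {N} → HasCard (InHrA r H A) N → length full-chain ≤ N
  lower-bound card = count card full-chain-unique (chain-mem (1 + m) ≤-refl)

  gaps-constant : ∀ {N} → HasCard (InHrA r H A) N → N ≤ length full-chain →
                  ∀ {i} → 3 + i ≤ length A → gap i ≡ gap (1 + i)
  gaps-constant card N≤L {i} 3+i≤k with gap i ≟ gap (1 + i)
  ... | yes gap≡ = gap≡
  ... | no gap≢ = contradiction (≤-trans (count card (Y∉full-chain ∷ full-chain-unique) (Y-mem 3+i≤3+m ∷ chain-mem (1 + m) ≤-refl)) N≤L)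
                                (n≮n _)
    where
    3+i≤3+m : 3 + i ≤ 3 + m
    3+i≤3+m = subst (_ ≤_) k≡ 3+i≤k
    Y∉full-chain : All (Y i ≢_) full-chain
    Y∉full-chain = proj₁ (Y∉chain gap≢ (s≤s (+-cancelˡ-≤ 3 _ _ 3+i≤3+m)) ≤-refl)

-- Arithmetic of the hypotheses

-- (k − 2) r ≤ hmin ≤ hmax < (k − 1) r, with s + D < r recorded as r = s + D + (w + 1).
record Decomposition (k r hmin hmax : ℕ) : Set where
  field
    m s D w : ℕ
    k≡    : k ≡ 3 + m
    r≡    : r ≡ s + (D + suc w)
    hmin≡ : hmin ≡ (1 + m) * r + s
    hmax≡ : hmax ≡ hmin + D

  u : ℕ
  u = D + suc w

  w<u : w < u
  w<u = m≤n+m (suc w) D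

  u≤r : u ≤ r
  u≤r = subst (u ≤_) (sym r≡) (m≤n+m u s)

  s<r : s < r
  s<r = subst (s <_) (sym r≡) (m<m+n s (≤-trans (s≤s z≤n) (m≤n+m (suc w) D)))

  hmin-total : hmin + (r + u) ≡ k * r
  hmin-total = begin
    hmin + (r + u)              ≡⟨ cong (_+ (r + u)) hmin≡ ⟩
    (1 + m) * r + s + (r + u)   ≡⟨ rearrange ((1 + m) * r) s r u ⟩
    (1 + m) * r + r + (s + u)   ≡⟨ cong (λ ρ → (1 + m) * r + r + ρ) (sym r≡) ⟩
    (1 + m) * r + r + r         ≡⟨ collect m r ⟩
    (3 + m) * r                 ≡⟨ cong (_* r) (sym k≡) ⟩
    k * r                       ∎
    where
    rearrange : ∀ a s r u → a + s + (r + u) ≡ a + r + (s + u)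
    rearrange = solve-∀
    collect : ∀ m r → (1 + m) * r + r + r ≡ (3 + m) * r
    collect = solve-∀

  hmax-total : hmax + (r + suc w) ≡ k * r
  hmax-total = trans (cong (_+ (r + suc w)) hmax≡) (trans (rearrange hmin D r (suc w)) hmin-total)
    where
    rearrange : ∀ h D r w → h + D + (r + w) ≡ h + (r + (D + w))
    rearrange = solve-∀

  balance : ∀ {L N t} → w + L ≡ r + (1 + m) * (r + u) → N + s * m ≡ 2 * r * (1 + m) + t → N + suc D ≡ L + t
  balance {L} {N} {t} length-L N≡ = +-cancelˡ-≡ (w + s * m) _ _ (begin
    w + s * m + (N + suc D)              ≡⟨ regroup₁ w s m N D ⟩
    N + s * m + (w + suc D)              ≡⟨ cong (_+ (w + suc D)) N≡ ⟩
    2 * r * (1 + m) + t + (w + suc D)    ≡⟨ subst (λ ρ → 2 * ρ * (1 + m) + t + (w + suc D) ≡ ρ + (1 + m) * (ρ + u) + (t + s * m))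
                                                  (sym r≡) (identity m s D w t) ⟩
    r + (1 + m) * (r + u) + (t + s * m)  ≡⟨ cong (_+ (t + s * m)) (sym length-L) ⟩
    w + L + (t + s * m)                  ≡⟨ regroup₂ w L t s m ⟩
    w + s * m + (L + t)                  ∎)
    where
    regroup₁ : ∀ w s m N D → w + s * m + (N + suc D) ≡ N + s * m + (w + suc D)
    regroup₁ = solve-∀
    identity : ∀ m s D w t → let ρ = s + (D + suc w) in
               2 * ρ * (1 + m) + t + (w + suc D) ≡ ρ + (1 + m) * (ρ + (D + suc w)) + (t + s * m)
    identity = solve-∀
    regroup₂ : ∀ w L t s m → w + L + (t + s * m) ≡ w + s * m + (L + t)
    regroup₂ = solve-∀

m∸1<n⇒m≤n : ∀ {m n} → m ∸ 1 < n → m ≤ n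
m∸1<n⇒m≤n {zero} _ = z≤n
m∸1<n⇒m≤n {suc m} m<n = m<n

decompose : ∀ {k r hmin hmax} → 3 ≤ k → (k ∸ 2) * r ∸ 1 < hmin → hmin ≤ hmax → hmax < (k ∸ 1) * r →
            Decomposition k r hmin hmax
decompose {k} {r} {hmin} {hmax} 3≤k lo hmin≤hmax hi = record
  { m = m ; s = s ; D = D ; w = r ∸ suc (s + D)
  ; k≡ = k≡ ; r≡ = r≡ ; hmin≡ = hmin≡ ; hmax≡ = hmax≡ }
  where
  m : ℕ
  m = k ∸ 3
  k≡ : k ≡ 3 + m
  k≡ = sym (m+[n∸m]≡n 3≤k)
  s : ℕ
  s = hmin ∸ (1 + m) * r
  hmin≡ : hmin ≡ (1 + m) * r + s
  hmin≡ = sym (m+[n∸m]≡n {(1 + m) * r} (m∸1<n⇒m≤n (subst (λ κ → (κ ∸ 2) * r ∸ 1 < hmin) k≡ lo)))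
  D : ℕ
  D = hmax ∸ hmin
  hmax≡ : hmax ≡ hmin + D
  hmax≡ = sym (m+[n∸m]≡n hmin≤hmax)
  s+D<r : s + D < r
  s+D<r = +-cancelˡ-< ((1 + m) * r) (s + D) r (subst₂ _<_ hmax≡′ (+-comm r _) (subst (λ κ → hmax < (κ ∸ 1) * r) k≡ hi))
    where
    hmax≡′ : hmax ≡ (1 + m) * r + (s + D)
    hmax≡′ = trans hmax≡ (trans (cong (_+ D) hmin≡) (+-assoc _ s D))
  r≡ : r ≡ s + (D + suc (r ∸ suc (s + D)))
  r≡ = trans (sym (m+[n∸m]≡n s+D<r)) (rearrange s D (r ∸ suc (s + D)))
    where
    rearrange : ∀ s D w → suc (s + D) + w ≡ s + (D + suc w)
    rearrange = solve-∀

divFloor-+ : ∀ {q r s} → s < r → divFloor (q * r + s) r ≡ q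
divFloor-+ {q} {suc r} {s} s<r = begin
  (q * suc r + s) / suc r          ≡⟨ +-distrib-/-∣ˡ s (divides q refl) ⟩
  q * suc r / suc r + s / suc r    ≡⟨ cong₂ _+_ (m*n/n≡m q (suc r)) (m<n⇒m/n≡0 s<r) ⟩
  q + 0                            ≡⟨ +-identityʳ q ⟩
  q                                ∎

formula-unfold : ∀ r k hmin t q → divFloor hmin r ≡ q →
  formula r k hmin t ≡ + q ℤ.* + r ℤ.* (+ k ℤ.- + q) ℤ.+ (+ hmin ℤ.- + q ℤ.* + r) ℤ.* (+ k ℤ.- + 2 ℤ.* + q ℤ.- + 1) ℤ.+ + t
formula-unfold r k hmin t _ refl = refl

formula-value : ∀ {r m s t N} → s < r → + N ≡ formula r (3 + m) ((1 + m) * r + s) t → N + s * m ≡ 2 * r * (1 + m) + t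
formula-value {r} {m} {s} {t} {N} s<r N≡ = ℤ.+-injective (begin
  + (N + s * m)                 ≡⟨ ℤ.pos-+ N (s * m) ⟩
  + N ℤ.+ + (s * m)             ≡⟨ cong₂ ℤ._+_ (trans N≡ (formula-unfold r (3 + m) hmin t (1 + m) (divFloor-+ s<r))) (ℤ.pos-* s m) ⟩
  _                             ≡⟨ identity (+ (1 + m)) (+ (3 + m)) (+ hmin) (+ r) (+ s) (+ t) (+ m)
                                            (ℤ.pos-+ 1 m) (ℤ.pos-+ 3 m) hmin≡ ⟩
  + 2 ℤ.* + r ℤ.* + (1 + m) ℤ.+ + t ≡⟨ cong (ℤ._+ + t) (trans (cong (ℤ._* + (1 + m)) (sym (ℤ.pos-* 2 r))) (sym (ℤ.pos-* (2 * r) (1 + m)))) ⟩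
  + (2 * r * (1 + m)) ℤ.+ + t   ≡⟨ sym (ℤ.pos-+ (2 * r * (1 + m)) t) ⟩
  + (2 * r * (1 + m) + t)       ∎)
  where
  hmin : ℕ
  hmin = (1 + m) * r + s
  hmin≡ : + hmin ≡ + (1 + m) ℤ.* + r ℤ.+ + s
  hmin≡ = trans (ℤ.pos-+ ((1 + m) * r) s) (cong (ℤ._+ + s) (ℤ.pos-* (1 + m) r))
  identity : ∀ (Q K Hm R S T M : ℤ.ℤ) → Q ≡ + 1 ℤ.+ M → K ≡ + 3 ℤ.+ M → Hm ≡ Q ℤ.* R ℤ.+ S →
    Q ℤ.* R ℤ.* (K ℤ.- Q) ℤ.+ (Hm ℤ.- Q ℤ.* R) ℤ.* (K ℤ.- + 2 ℤ.* Q ℤ.- + 1) ℤ.+ T ℤ.+ S ℤ.* M ≡ + 2 ℤ.* R ℤ.* Q ℤ.+ T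
  identity _ _ _ R S T M refl refl refl = polynomial R S T M
    where
    polynomial : ∀ R S T M →
      (+ 1 ℤ.+ M) ℤ.* R ℤ.* ((+ 3 ℤ.+ M) ℤ.- (+ 1 ℤ.+ M))
      ℤ.+ ((+ 1 ℤ.+ M) ℤ.* R ℤ.+ S ℤ.- (+ 1 ℤ.+ M) ℤ.* R) ℤ.* ((+ 3 ℤ.+ M) ℤ.- + 2 ℤ.* (+ 1 ℤ.+ M) ℤ.- + 1)
      ℤ.+ T ℤ.+ S ℤ.* M ≡ + 2 ℤ.* R ℤ.* (+ 1 ℤ.+ M) ℤ.+ T
    polynomial = ℤ-Solver.solve-∀

corollary3p7 : (r : ℕ) → 2 ≤ r →
    (A : List ℕ) → Unique A → 7 ≤ length A → 0 ∈ A →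
    (H : List ℕ) → Unique H → 2 ≤ length H → All (λ h → 1 ≤ h) H →
    (hmin hmax : ℕ) → IsMin H hmin → IsMax H hmax →
    (length A ∸ 2) * r ∸ 1 < hmin → hmin < hmax → hmax < (length A ∸ 1) * r →
    (N : ℕ) → HasCard (InHrA r H A) N →
    + N ≡ formula r (length A) hmin (length H) →
    ∃ λ d → d ≤ r ∸ 1 × IsAP H d ×
      (∀ a₁ → IsMinNonzero A a₁ → IsAP A (d * a₁))
corollary3p7 r 2≤r A A! 7≤k 0∈A H H! _ _ hmin hmax (hmin∈H , hmin≤) (hmax∈H , ≤hmax) lo hmin<hmax hi N card N≡formula =
  1 , ∸-monoˡ-≤ 1 2≤r , IsAP-⊆⊇ H⊆I I⊆H , A-AP
  where
  open Decomposition (decompose (≤-trans (s≤s (s≤s (s≤s z≤n))) 7≤k) lo (<⇒≤ hmin<hmax) hi)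
  e : IncreasingEnumeration A
  e = enumerate A! 0∈A
  open IncreasingEnumeration e using (minNonzero≡gap₀; IsAP-of-constant-gaps)
  open LowerBound 2≤r u≤r w<u k≡ e hmin∈H hmax∈H hmin-total hmax-total
  N+1+D≡L+t : N + suc D ≡ length full-chain + length H
  N+1+D≡L+t = balance length-full-chain
    (formula-value s<r (subst₂ (λ κ η → + N ≡ formula r κ η (length H)) k≡ hmin≡ N≡formula))
  I : List ℕ
  I = progression hmin 1 (suc D)
  H⊆I : H ⊆ I
  H⊆I {h} h∈H = ∈-interval (hmin≤ h h∈H) (subst (h ≤_) hmax≡ (≤hmax h h∈H))
  t≤1+D : length H ≤ suc D
  t≤1+D = subst (length H ≤_) (length-progression hmin 1 (suc D)) (length-≤-⊆ H! H⊆I)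
  N≤L : N ≤ length full-chain
  N≤L = +-cancelʳ-≤ (suc D) N _ (subst (_≤ length full-chain + suc D) (sym N+1+D≡L+t) (+-monoʳ-≤ (length full-chain) t≤1+D))
  1+D≤t : suc D ≤ length H
  1+D≤t = +-cancelˡ-≤ (length full-chain) _ _ (subst (length full-chain + suc D ≤_) N+1+D≡L+t (+-monoˡ-≤ (suc D) (lower-bound card)))
  I⊆H : I ⊆ H
  I⊆H = ⊆∧length≤⇒⊇ H! H⊆I (subst (_≤ length H) (sym (length-progression hmin 1 (suc D))) 1+D≤t)
  A-AP : ∀ a₁ → IsMinNonzero A a₁ → IsAP A (1 * a₁)
  A-AP a₁ a₁-min = subst (IsAP A) (sym (trans (*-identityˡ a₁) (minNonzero≡gap₀ (≤-trans (s≤s (s≤s z≤n)) 7≤k) a₁-min)))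
                         (IsAP-of-constant-gaps (gaps-constant card N≤L))
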